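{- Let $k\ge4$, let $\tau=(\rho',1,k)\in\mathfrak M_k$, and let $\rho\in\mathfrak M_{k-2}$ be the permutation obtained by decreasing each entry of $\rho'$ by $1$. Then $$N_\tau(x)=\frac{1}{1-x-x^2N_\rho(x)}.$$
   Context: A permutation $\pi=\pi_1\cdots\pi_n$ is a Motzkin permutation if it avoids the pattern $132$ (no $i<j<k$ with $\pi_i<\pi_k<\pi_j$) and there are no indices $a<b$ with $\pi_a<\pi_b<\pi_{b+1}$; $\mathfrak M_n$ is the set of them. For a permutation $\sigma$, $N_\sigma(x)=\sum_{n\ge0}|\mathfrak M_n(\sigma)|x^n$, where $\mathfrak M_n(\sigma)$ is the set of Motzkin permutations of length $n$ avoiding $\sigma$ in the classical sense (no subsequence order-isomorphic to $\sigma$). $(\rho',1,k)$ denotes the sequence $\rho'$ followed by $1$ and $k$. -}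

module Defs where

open import Data.Bool using (Bool; true; false; _∧_; _∨_; not; T)
open import Data.Nat using (ℕ; zero; suc; _+_; _*_; _∸_; _≤ᵇ_; _<ᵇ_; _≡ᵇ_; pred)
open import Data.List using (List; []; _∷_; _++_; [_]; length; map)
open import Data.Bool.ListAction using (all; any)
open import Data.Product using (Σ)
open import Data.Fin using (Fin)
open import Function.Bundles using (_↔_)

-- Permutations are lists of natural numbers in one-line notation π₁ ⋯ πₙ.

notIn : ℕ → List ℕ → Bool
notIn x xs = all (λ y → not (x ≡ᵇ y)) xs

distinct : List ℕ → Bool
distinct []       = true
distinct (x ∷ xs) = notIn x xs ∧ distinct xs

isPermOf : ℕ → List ℕ → Bool
isPermOf n π = (length π ≡ᵇ n) ∧ all (λ x → (1 ≤ᵇ x) ∧ (x ≤ᵇ n)) π ∧ distinct π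

subseqs : List ℕ → List (List ℕ)
subseqs []       = [] ∷ []
subseqs (x ∷ xs) = map (x ∷_) (subseqs xs) ++ subseqs xs

all2 : (ℕ → ℕ → Bool) → List ℕ → List ℕ → Bool
all2 p []       []       = true
all2 p (x ∷ xs) (y ∷ ys) = p x y ∧ all2 p xs ys
all2 p _        _        = false

-- order-isomorphism of two sequences of distinct entries:
-- same length and for all i < j, (xᵢ < xⱼ) ⇔ (yᵢ < yⱼ)
orderIso : List ℕ → List ℕ → Bool
orderIso []       []       = true
orderIso (x ∷ xs) (y ∷ ys) = all2 (λ x' y' → (x <ᵇ x') ≡ᵇᵇ (y <ᵇ y')) xs ys ∧ orderIso xs ys
  where
  _≡ᵇᵇ_ : Bool → Bool → Bool
  true  ≡ᵇᵇ b = b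
  false ≡ᵇᵇ b = not b
orderIso _        _        = false

contains : List ℕ → List ℕ → Bool
contains π σ = any (λ s → orderIso s σ) (subseqs π)

avoids : List ℕ → List ℕ → Bool
avoids π σ = not (contains π σ)

-- no indices a < b with π_a < π_b < π_{b+1}
-- (prefix = the entries before the current position b)
noRise : List ℕ → List ℕ → Bool
noRise prefix (x ∷ y ∷ rest) =
  not ((x <ᵇ y) ∧ any (λ z → z <ᵇ x) prefix) ∧ noRise (prefix ++ [ x ]) (y ∷ rest)
noRise prefix _ = true

isMotzkin : List ℕ → Bool
isMotzkin π = avoids π (1 ∷ 3 ∷ 2 ∷ []) ∧ noRise [] π

inM : ℕ → List ℕ → Bool
inM n π = isPermOf n π ∧ isMotzkin π

-- 𝔐ₙ(σ) as a type (membership predicate is a proposition, being T of a Bool)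
M : ℕ → List ℕ → Set
M n σ = Σ (List ℕ) (λ π → T (inM n π ∧ avoids π σ))

Counts : (ℕ → ℕ) → List ℕ → Set
Counts a σ = ∀ n → Fin (a n) ↔ M n σ

-- Cauchy convolution coefficient: Σ_{i=0}^{n} b i * a (n - i)
conv : (ℕ → ℕ) → (ℕ → ℕ) → ℕ → ℕ
conv b a zero    = b 0 * a 0
conv b a (suc n) = b (suc n) * a 0 + conv b (λ i → a (suc i)) n

{-# OPTIONS --safe #-}
-- A Motzkin permutation π of length n + 2 avoiding τ = ρ′ 1 k has its entry 1 in one of the last
-- two places: entries x, y following the 1 would form either the forbidden rise 1 < x < y or the
-- pattern 1 x y ≅ 132.  If π = σ 1, then σ − 1 is a τ-avoider of length n + 1.  If π = σ 1 j,
-- avoiding 132 in σ j splits σ into a block above j followed by a block below j, shifted copies of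
-- some γ and δ.  An occurrence of τ in π ending above j lies inside the upper block, and one ending
-- at most at j has its ρ′-part inside the lower block; hence π avoids τ exactly when γ avoids τ and
-- δ avoids ρ.  Conversely every σ, and every such pair (δ, γ), assembles into a τ-avoider.  The
-- resulting bijection 𝔐ₙ₊₂(τ) ≅ 𝔐ₙ₊₁(τ) ⊎ Σᵢ₊ₘ₌ₙ 𝔐ᵢ(ρ) × 𝔐ₘ(τ) is the coefficientwise form of
-- N_τ = 1 + x N_τ + x² N_ρ N_τ.
module Submission where

open import Defs
open import Data.Bool using (Bool; true; false; T; not; _∧_)
open import Data.Bool.ListAction using (all; any)
open import Data.Bool.Properties using (T-∧; T-irrelevant)
open import Data.Empty using (⊥; ⊥-elim)
open import Data.Fin using (Fin; zero)
open import Data.Fin.Permutation using (↔⇒≡)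
open import Data.Fin.Properties using (+↔⊎; *↔×)
open import Data.List using (List; []; _∷_; _++_; [_]; map; length; filter)
open import Data.List.Membership.Propositional using (_∈_; _∉_; find; lose)
open import Data.List.Membership.Propositional.Properties using (∈-++⁻; ∈-++⁺ˡ; ∈-++⁺ʳ; ∈-map⁺; ∈-map⁻; ∈-∃++)
open import Data.List.Properties
  using ( ++-assoc; ++-identityʳ; ++-cancelʳ; ∷-injective; ∷ʳ-injective; ∷ʳ-injectiveˡ; ∷ʳ-injectiveʳ
        ; length-++; length-map; map-++; map-∘; map-id-local; map-injective
        ; filter-all; filter-accept; filter-reject )
open import Data.List.Relation.Binary.Pointwise as Pointwise using (Pointwise; []; _∷_; Pointwise-length)
open import Data.List.Relation.Binary.Sublist.Propositional
  using (_⊆_; []; _∷_; _∷ʳ_; ⊆-refl; ⊆-trans; lookup; minimum; from∈)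
open import Data.List.Relation.Binary.Sublist.Propositional.Properties
  using (length-mono-≤; All-resp-⊆; ++⁺ˡ; ++⁺ʳ) renaming (++⁺ to ⊆-++⁺; map⁺ to ⊆-map⁺)
open import Data.List.Relation.Unary.All as All using (All; []; _∷_)
import Data.List.Relation.Unary.All.Properties as Allₚ
open import Data.List.Relation.Unary.All.Properties.Core using (¬Any⇒All¬)
open import Data.List.Relation.Unary.Any using (here; there)
open import Data.List.Relation.Unary.Any.Properties using (any⁺; any⁻)
open import Data.List.Relation.Unary.Unique.Propositional using (Unique; []; _∷_)
import Data.List.Relation.Unary.Unique.Propositional.Properties as Uniqueₚ
open import Data.Nat
  using (ℕ; zero; suc; pred; _+_; _∸_; _<_; _≤_; _<ᵇ_; _≤ᵇ_; _≡ᵇ_; _≟_; z≤n; s≤s; s≤s⁻¹)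
open import Data.Nat.Properties
  using ( ≡ᵇ⇒≡; ≡⇒≡ᵇ; ≤ᵇ⇒≤; ≤⇒≤ᵇ; <ᵇ-reflects-<; ≡-irrelevant; suc-injective
        ; ≤-refl; ≤-reflexive; ≤-trans; ≤-antisym; <-trans; ≤-<-trans; <-≤-trans; <-irrefl; <-asym; <-cmp
        ; ≮⇒≥; <⇒≱; <⇒≤; ≤∧≢⇒<; m≤n⇒m≤1+n; m≤m+n; m≤n+m; m<m+n
        ; +-comm; +-suc; +-identityʳ; +-cancelˡ-≡; +-cancelʳ-≡; +-cancelˡ-≤; +-cancelʳ-≤
        ; +-monoˡ-≤; +-monoʳ-≤; +-monoʳ-<; m+[n∸m]≡n; m∸n+n≡m; m<n⇒0<n∸m; ∸-monoˡ-≤ )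
open import Data.List.Membership.DecPropositional _≟_ using (_∈?_)
open import Data.Product as Product using (Σ-syntax; ∃-syntax; ∃₂; _×_; _,_; proj₁; proj₂)
open import Data.Product.Function.NonDependent.Propositional using (_×-↔_)
open import Data.Sum using (_⊎_; inj₁; inj₂) renaming ([_,_] to either)
open import Data.Sum.Function.Propositional using (_⊎-↔_)
open import Function using (_∘_; const)
open import Function.Bundles using (_⇔_; mk⇔; Equivalence; _↔_; mk↔ₛ′)
open import Function.Construct.Composition using (_⇔-∘_)
open import Function.Construct.Symmetry using (⇔-sym; ↔-sym)
open import Function.Properties.Inverse using (↔-trans)
open import Function.Related.Propositional using (module EquationalReasoning)
open import Relation.Binary.Core using (_Preserves_⟶_)
open import Relation.Binary.Definitions using (Tri; tri<; tri≈; tri>)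
open import Relation.Binary.PropositionalEquality
  using (_≡_; _≢_; refl; sym; trans; cong; cong₂; subst; subst₂; ≢-sym; module ≡-Reasoning)
open import Relation.Nullary using (¬_; Dec; yes; no; ¬?)
open import Relation.Nullary.Reflects using (ofʸ; ofⁿ)

open Equivalence using (to; from)

-- Order isomorphism

SameOrder : ℕ → ℕ → ℕ → ℕ → Set
SameOrder x y a b = x < a ⇔ y < b

infix 4 _≅_
data _≅_ : List ℕ → List ℕ → Set where
  []  : [] ≅ []
  _∷_ : ∀ {x y xs ys} → Pointwise (SameOrder x y) xs ys → xs ≅ ys → x ∷ xs ≅ y ∷ ys

≅-length : ∀ {s t} → s ≅ t → length s ≡ length t
≅-length []      = refl
≅-length (_ ∷ r) = cong suc (≅-length r)

≅-head : ∀ {x y xs ys} → x ∷ xs ≅ y ∷ ys → Pointwise (SameOrder x y) xs ys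
≅-head (p ∷ _) = p

≅-sym : ∀ {s t} → s ≅ t → t ≅ s
≅-sym []      = []
≅-sym (p ∷ r) = Pointwise.symmetric ⇔-sym p ∷ ≅-sym r

CrossOrder : List ℕ → List ℕ → List ℕ → List ℕ → Set
CrossOrder u R v S = Pointwise (λ a r → Pointwise (SameOrder a r) v S) u R

Pointwise-++⁻ : ∀ {W : ℕ → ℕ → Set} u {v r w} → length u ≡ length r →
                Pointwise W (u ++ v) (r ++ w) → Pointwise W u r × Pointwise W v w
Pointwise-++⁻ []      {r = []}    _  p       = [] , p
Pointwise-++⁻ (_ ∷ u) {r = _ ∷ r} eq (e ∷ p) = Product.map₁ (e ∷_) (Pointwise-++⁻ u (suc-injective eq) p)

Pointwise-fromAll : ∀ {P Q : ℕ → Set} {W : ℕ → ℕ → Set} {xs ys} → (∀ {a b} → P a → Q b → W a b) →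
                    length xs ≡ length ys → All P xs → All Q ys → Pointwise W xs ys
Pointwise-fromAll f _  []       []       = []
Pointwise-fromAll f eq (p ∷ ps) (q ∷ qs) = f p q ∷ Pointwise-fromAll f (suc-injective eq) ps qs

All-pullback : ∀ {W : ℕ → ℕ → Set} {P Q : ℕ → Set} {xs ys} →
               (∀ {a b} → W a b → P b → Q a) → Pointwise W xs ys → All P ys → All Q xs
All-pullback f []      []       = []
All-pullback f (e ∷ p) (b ∷ bs) = f e b ∷ All-pullback f p bs

Pointwise-∈ʳ : ∀ {W : ℕ → ℕ → Set} {xs ys y} → Pointwise W xs ys → y ∈ ys → ∃[ x ] x ∈ xs × W x y
Pointwise-∈ʳ (e ∷ _) (here refl) = _ , here refl , e
Pointwise-∈ʳ (_ ∷ p) (there y∈)  = Product.map₂ (Product.map₁ there) (Pointwise-∈ʳ p y∈)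

≅-++⁺ : ∀ {u R v S} → u ≅ R → v ≅ S → CrossOrder u R v S → u ++ v ≅ R ++ S
≅-++⁺ []      q []       = q
≅-++⁺ (p ∷ r) q (c ∷ cs) = Pointwise.++⁺ p c ∷ ≅-++⁺ r q cs

≅-++⁻ : ∀ R {S s} → s ≅ R ++ S → ∃₂ λ u v → s ≡ u ++ v × u ≅ R × v ≅ S × CrossOrder u R v S
≅-++⁻ []      q = [] , _ , refl , [] , q , []
≅-++⁻ (r ∷ R) (p ∷ q)
  with u , v , refl , u≅R , v≅S , cross ← ≅-++⁻ R q
  with pu , pv ← Pointwise-++⁻ u (≅-length u≅R) p
  = _ ∷ u , v , refl , pu ∷ u≅R , v≅S , pv ∷ cross

132-pattern : List ℕ
132-pattern = 1 ∷ 3 ∷ 2 ∷ []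

≅132 : ∀ {a b c} → a < c → c < b → a ∷ b ∷ c ∷ [] ≅ 132-pattern
≅132 a<c c<b =
  (mk⇔ (const (s≤s (s≤s z≤n))) (const (<-trans a<c c<b)) ∷ mk⇔ (const (s≤s (s≤s z≤n))) (const a<c) ∷ []) ∷
  (mk⇔ (λ b<c → ⊥-elim (<-asym b<c c<b)) (λ { (s≤s (s≤s ())) }) ∷ []) ∷
  [] ∷ []

-- The comparison inside Defs.orderIso is local to its definition, so it only computes at explicit
-- positions of the two lists; hence the positional formulation of the next lemmas.

all2-at : ∀ P Q {p : ℕ → ℕ → Bool} {a b us vs} → length P ≡ length Q →
          T (all2 p (P ++ a ∷ us) (Q ++ b ∷ vs)) → T (p a b)
all2-at []      []      {p} {a} {b} _  h = proj₁ (to (T-∧ {p a b}) h)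
all2-at (c ∷ P) (d ∷ Q) {p}         eq h = all2-at P Q (suc-injective eq) (proj₂ (to (T-∧ {p c d}) h))

all2-false : ∀ {p : ℕ → ℕ → Bool} L M → length L ≡ length M → all2 p L M ≡ false →
             ∃₂ λ P Q → ∃₂ λ a b → ∃₂ λ us vs →
               L ≡ P ++ a ∷ us × M ≡ Q ++ b ∷ vs × length P ≡ length Q × p a b ≡ false
all2-false         []      []      _  ()
all2-false {p} (a ∷ L) (b ∷ M) eq h with p a b in pab
... | false = [] , [] , a , b , L , M , refl , refl , refl , pab
... | true with P , Q , a′ , b′ , us , vs , refl , refl , ePQ , p′ ← all2-false L M (suc-injective eq) h
  = a ∷ P , b ∷ Q , a′ , b′ , us , vs , refl , refl , cong suc ePQ , p′

Pointwise-at : ∀ {W : ℕ → ℕ → Set} P Q {a b us vs} → length P ≡ length Q →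
               Pointwise W (P ++ a ∷ us) (Q ++ b ∷ vs) → W a b
Pointwise-at []      []      _  (w ∷ _)  = w
Pointwise-at (_ ∷ P) (_ ∷ Q) eq (_ ∷ ws) = Pointwise-at P Q (suc-injective eq) ws

∧-≡-false : ∀ a {b} → a ∧ b ≡ false → T b → a ≡ false
∧-≡-false false _       _ = refl
∧-≡-false true  b≡false t = ⊥-elim (subst T b≡false t)

orderIso-length : ∀ s t → T (orderIso s t) → length s ≡ length t
orderIso-length []      []      _ = refl
orderIso-length (x ∷ s) (y ∷ t) h = cong suc (orderIso-length s t (proj₂ (to (T-∧ {all2 _ s t}) h)))

orderIso-sameOrder : ∀ {x y} P Q {a b us vs} → length P ≡ length Q →
                     T (orderIso (x ∷ P ++ a ∷ us) (y ∷ Q ++ b ∷ vs)) → SameOrder x y a b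
orderIso-sameOrder {x} {y} P Q {a} {b} {us} {vs} eq h
  with x <ᵇ a | <ᵇ-reflects-< x a | y <ᵇ b | <ᵇ-reflects-< y b
     | all2-at P Q eq (proj₁ (to (T-∧ {all2 _ (P ++ a ∷ us) (Q ++ b ∷ vs)}) h))
... | true  | ofʸ x<a | true  | ofʸ y<b | _ = mk⇔ (const y<b) (const x<a)
... | false | ofⁿ x≮a | false | ofⁿ y≮b | _ = mk⇔ (⊥-elim ∘ x≮a) (⊥-elim ∘ y≮b)
... | true  | _       | false | _       | ()
... | false | _       | true  | _       | ()

orderIso-∷⁻ : ∀ {x y} L M → T (orderIso (x ∷ L) (y ∷ M)) → Pointwise (SameOrder x y) L M
orderIso-∷⁻ {x} {y} L M h = go [] [] L M refl (suc-injective (orderIso-length (x ∷ L) (y ∷ M) h)) h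
  where
  go : ∀ P Q L′ M′ → length P ≡ length Q → length L′ ≡ length M′ →
       T (orderIso (x ∷ P ++ L′) (y ∷ Q ++ M′)) → Pointwise (SameOrder x y) L′ M′
  go P Q []       []       _   _   _ = []
  go P Q (a ∷ L′) (b ∷ M′) ePQ eLM h =
    orderIso-sameOrder P Q ePQ h ∷
    go (P ++ [ a ]) (Q ++ [ b ]) L′ M′
       (trans (length-++ P) (trans (cong (_+ 1) ePQ) (sym (length-++ Q))))
       (suc-injective eLM)
       (subst₂ (λ U V → T (orderIso (x ∷ U) (y ∷ V))) (sym (++-assoc P [ a ] L′)) (sym (++-assoc Q [ b ] M′)) h)

orderIso-∷⁺ : ∀ {x y L M} → Pointwise (SameOrder x y) L M → T (orderIso L M) → T (orderIso (x ∷ L) (y ∷ M))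
orderIso-∷⁺ {x} {y} {L} {M} pw o with orderIso (x ∷ L) (y ∷ M) in eq
... | true  = _
... | false
  with P , Q , a , b , us , vs , refl , refl , ePQ , pab≡false
         ← all2-false L M (Pointwise-length pw) (∧-≡-false (all2 _ L M) eq o)
  with x <ᵇ a | <ᵇ-reflects-< x a | y <ᵇ b | <ᵇ-reflects-< y b | Pointwise-at P Q ePQ pw | pab≡false
... | true  | _       | true  | _       | _     | ()
... | false | _       | false | _       | _     | ()
... | true  | ofʸ x<a | false | ofⁿ y≮b | xa∼yb | _ = y≮b (to xa∼yb x<a)
... | false | ofⁿ x≮a | true  | ofʸ y<b | xa∼yb | _ = x≮a (from xa∼yb y<b)

orderIso⇔≅ : ∀ {s t} → T (orderIso s t) ⇔ s ≅ t
orderIso⇔≅ = mk⇔ (sound _ _) complete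
  where
  sound : ∀ s t → T (orderIso s t) → s ≅ t
  sound []      []      _ = []
  sound (x ∷ s) (y ∷ t) h = orderIso-∷⁻ s t h ∷ sound s t (proj₂ (to (T-∧ {all2 _ s t}) h))
  complete : ∀ {s t} → s ≅ t → T (orderIso s t)
  complete []      = _
  complete (p ∷ r) = orderIso-∷⁺ p (complete r)

-- Pattern containment

Contains : List ℕ → List ℕ → Set
Contains π σ = ∃[ s ] s ⊆ π × s ≅ σ

∈-subseqs⇔⊆ : ∀ {s} π → s ∈ subseqs π ⇔ s ⊆ π
∈-subseqs⇔⊆ π = mk⇔ (sound π) complete
  where
  sound : ∀ {s} π → s ∈ subseqs π → s ⊆ π
  sound []      (here refl) = []
  sound (x ∷ π) s∈ with ∈-++⁻ (map (x ∷_) (subseqs π)) s∈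
  ... | inj₁ s∈₁ with _ , s′∈ , refl ← ∈-map⁻ (x ∷_) s∈₁ = refl ∷ sound π s′∈
  ... | inj₂ s∈₂ = x ∷ʳ sound π s∈₂
  complete : ∀ {s π} → s ⊆ π → s ∈ subseqs π
  complete []                   = here refl
  complete (_∷ʳ_ {ys = π} y p) = ∈-++⁺ʳ (map (y ∷_) (subseqs π)) (complete p)
  complete (refl ∷ p)           = ∈-++⁺ˡ (∈-map⁺ (_ ∷_) (complete p))

contains⇔Contains : ∀ {π σ} → T (contains π σ) ⇔ Contains π σ
contains⇔Contains {π} {σ} = mk⇔ sound complete
  where
  sound : T (contains π σ) → Contains π σ
  sound h with s , s∈ , o ← find (any⁻ _ (subseqs π) h) = s , to (∈-subseqs⇔⊆ π) s∈ , to orderIso⇔≅ o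
  complete : Contains π σ → T (contains π σ)
  complete (s , s⊆π , s≅σ) = any⁺ _ (lose (from (∈-subseqs⇔⊆ π) s⊆π) (from orderIso⇔≅ s≅σ))

avoids⇔ : ∀ {π σ} → T (avoids π σ) ⇔ (¬ Contains π σ)
avoids⇔ {π} {σ} with contains π σ | contains⇔Contains {π} {σ}
... | true  | c = mk⇔ (λ ()) (λ ¬c → ¬c (to c _))
... | false | c = mk⇔ (λ _ → from c) (const _)

Contains-⊆ : ∀ {π π′ σ} → π ⊆ π′ → Contains π σ → Contains π′ σ
Contains-⊆ π⊆π′ (s , s⊆π , s≅σ) = s , ⊆-trans s⊆π π⊆π′ , s≅σ

Contains-length : ∀ {π σ} → Contains π σ → length σ ≤ length π
Contains-length {π} (s , s⊆π , s≅σ) = subst (_≤ length π) (≅-length s≅σ) (length-mono-≤ s⊆π)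

⊆-map⁻ : ∀ (f : ℕ → ℕ) π {s′} → s′ ⊆ map f π → ∃[ s ] s′ ≡ map f s × s ⊆ π
⊆-map⁻ f []      []         = [] , refl , []
⊆-map⁻ f (x ∷ π) (_ ∷ʳ p)   = Product.map₂ (Product.map₂ (x ∷ʳ_)) (⊆-map⁻ f π p)
⊆-map⁻ f (x ∷ π) (refl ∷ p) with s , refl , q ← ⊆-map⁻ f π p = x ∷ s , refl , refl ∷ q

⊆-++⁻ : ∀ (A : List ℕ) {B s} → s ⊆ A ++ B → ∃₂ λ s₁ s₂ → s ≡ s₁ ++ s₂ × s₁ ⊆ A × s₂ ⊆ B
⊆-++⁻ []      p          = [] , _ , refl , [] , p
⊆-++⁻ (a ∷ A) (_ ∷ʳ p)   with s₁ , s₂ , refl , p₁ , p₂ ← ⊆-++⁻ A p = s₁ , s₂ , refl , a ∷ʳ p₁ , p₂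
⊆-++⁻ (a ∷ A) (refl ∷ p) with s₁ , s₂ , refl , p₁ , p₂ ← ⊆-++⁻ A p = a ∷ s₁ , s₂ , refl , refl ∷ p₁ , p₂

⊆-∷ʳ⁻ : ∀ (π : List ℕ) {x s} → s ⊆ π ++ [ x ] → s ⊆ π ⊎ ∃[ s′ ] s ≡ s′ ++ [ x ] × s′ ⊆ π
⊆-∷ʳ⁻ []      (_ ∷ʳ [])   = inj₁ []
⊆-∷ʳ⁻ []      (refl ∷ []) = inj₂ ([] , refl , [])
⊆-∷ʳ⁻ (y ∷ π) (_ ∷ʳ p) with ⊆-∷ʳ⁻ π p
... | inj₁ q             = inj₁ (y ∷ʳ q)
... | inj₂ (s′ , eq , q) = inj₂ (s′ , eq , y ∷ʳ q)
⊆-∷ʳ⁻ (y ∷ π) (refl ∷ p) with ⊆-∷ʳ⁻ π p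
... | inj₁ q               = inj₁ (refl ∷ q)
... | inj₂ (s′ , refl , q) = inj₂ (y ∷ s′ , refl , refl ∷ q)

∷ʳ-⊆-++ : ∀ (A s : List ℕ) {B y} → s ++ [ y ] ⊆ A ++ B → y ∉ B → s ++ [ y ] ⊆ A
∷ʳ-⊆-++ []      s       p          y∉B = ⊥-elim (y∉B (lookup p (∈-++⁺ʳ s (here refl))))
∷ʳ-⊆-++ (a ∷ A) []      (_ ∷ʳ p)   y∉B = a ∷ʳ ∷ʳ-⊆-++ A [] p y∉B
∷ʳ-⊆-++ (a ∷ A) []      (refl ∷ _) _   = refl ∷ minimum A
∷ʳ-⊆-++ (a ∷ A) (c ∷ s) (_ ∷ʳ p)   y∉B = a ∷ʳ ∷ʳ-⊆-++ A (c ∷ s) p y∉B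
∷ʳ-⊆-++ (a ∷ A) (c ∷ s) (refl ∷ p) y∉B = refl ∷ ∷ʳ-⊆-++ A s p y∉B

⊆-++-∉ˡ : ∀ (A : List ℕ) {B s} → s ⊆ A ++ B → All (_∉ A) s → s ⊆ B
⊆-++-∉ˡ []      p          _        = p
⊆-++-∉ˡ (a ∷ A) (_ ∷ʳ p)   ∉A       = ⊆-++-∉ˡ A p (All.map (_∘ there) ∉A)
⊆-++-∉ˡ (a ∷ A) (refl ∷ p) (a∉ ∷ _) = ⊥-elim (a∉ (here refl))

⊆-++-∉ʳ : ∀ (A : List ℕ) {B s} → s ⊆ A ++ B → All (_∉ B) s → s ⊆ A
⊆-++-∉ʳ []      {s = []}    _          _        = []
⊆-++-∉ʳ []      {s = _ ∷ _} p          (c∉ ∷ _) = ⊥-elim (c∉ (lookup p (here refl)))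
⊆-++-∉ʳ (a ∷ A)             (_ ∷ʳ p)   ∉B       = a ∷ʳ ⊆-++-∉ʳ A p ∉B
⊆-++-∉ʳ (a ∷ A)             (refl ∷ p) (_ ∷ ∉B) = refl ∷ ⊆-++-∉ʳ A p ∉B

_≪_ : List ℕ → List ℕ → Set
xs ≪ ys = All (λ x → All (x <_) ys) xs

Contains-++-≪ : ∀ {A B h σ} → B ≪ A → All (h <_) σ → Contains (A ++ B) (h ∷ σ) →
                Contains A (h ∷ σ) ⊎ Contains B (h ∷ σ)
Contains-++-≪ {A} B≪A h<σ (s , s⊆ , s≅) with ⊆-++⁻ A s⊆
... | []     , s₂     , refl , _  , p₂ = inj₂ (s₂ , p₂ , s≅)
... | s₁     , []     , refl , p₁ , _  = inj₁ (s₁ , p₁ , subst (_≅ _) (++-identityʳ s₁) s≅)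
... | a ∷ s₁ , b ∷ s₂ , refl , p₁ , p₂ = ⊥-elim (<-asym a<b b<a)
  where
  a<b : a < b
  a<b = All.lookup (All-pullback (λ e h<r → from e h<r) (≅-head s≅) h<σ) (∈-++⁺ʳ s₁ (here refl))
  b<a : b < a
  b<a = All.lookup (All.lookup B≪A (lookup p₂ (here refl))) (lookup p₁ (here refl))

Contains-∷ʳ⁻ : ∀ {π x σ z w} → w ∈ σ → All (λ a → ¬ SameOrder a w x z) π →
               Contains (π ++ [ x ]) (σ ++ [ z ]) → Contains π (σ ++ [ z ])
Contains-∷ʳ⁻ {π} {σ = σ} w∈σ incompatible (s , s⊆ , s≅) with ⊆-∷ʳ⁻ π s⊆
... | inj₁ s⊆π = s , s⊆π , s≅
... | inj₂ (s′ , refl , s′⊆π)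
  with u , _ ∷ [] , eq , _ , _ ∷ [] , cross ← ≅-++⁻ σ s≅
  with refl , refl ← ∷ʳ-injective s′ u eq
  with a , a∈u , e ∷ [] ← Pointwise-∈ʳ cross w∈σ
  = ⊥-elim (All.lookup incompatible (lookup s′⊆π a∈u) e)

-- Rise-free sequences

-- RiseFree p π: no ascent x < y of π starts above an entry of p or an earlier entry of π
-- (p is the prefix argument of Defs.noRise).
data RiseFree : List ℕ → List ℕ → Set where
  []  : ∀ {p} → RiseFree p []
  [-] : ∀ {p x} → RiseFree p [ x ]
  _∷_ : ∀ {p x y r} → (x < y → All (x ≤_) p) → RiseFree (p ++ [ x ]) (y ∷ r) → RiseFree p (x ∷ y ∷ r)

noneBelow⇔ : ∀ {x} p → T (not (any (_<ᵇ x) p)) ⇔ All (x ≤_) p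
noneBelow⇔         []      = mk⇔ (const []) (const _)
noneBelow⇔ {x} (z ∷ p) with z <ᵇ x | <ᵇ-reflects-< z x
... | true  | ofʸ z<x = mk⇔ (λ ()) (λ { (x≤z ∷ _) → <⇒≱ z<x x≤z })
... | false | ofⁿ z≮x = mk⇔ (λ h → ≮⇒≥ z≮x ∷ to (noneBelow⇔ p) h) (λ { (_ ∷ x≤p) → from (noneBelow⇔ p) x≤p })

ascent⇔ : ∀ {x y} p → T (not ((x <ᵇ y) ∧ any (_<ᵇ x) p)) ⇔ (x < y → All (x ≤_) p)
ascent⇔ {x} {y} p with x <ᵇ y | <ᵇ-reflects-< x y
... | true  | ofʸ x<y = mk⇔ (λ h _ → to (noneBelow⇔ p) h) (λ f → from (noneBelow⇔ p) (f x<y))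
... | false | ofⁿ x≮y = mk⇔ (λ _ x<y → ⊥-elim (x≮y x<y)) (const _)

noRise⇔RiseFree : ∀ {p π} → T (noRise p π) ⇔ RiseFree p π
noRise⇔RiseFree = mk⇔ (sound _ _) complete
  where
  sound : ∀ p π → T (noRise p π) → RiseFree p π
  sound p []          _ = []
  sound p (x ∷ [])    _ = [-]
  sound p (x ∷ y ∷ r) h = to (ascent⇔ p) (proj₁ h′) ∷ sound (p ++ [ x ]) (y ∷ r) (proj₂ h′)
    where
    h′ : T (not ((x <ᵇ y) ∧ any (_<ᵇ x) p)) × T (noRise (p ++ [ x ]) (y ∷ r))
    h′ = to T-∧ h
  complete : ∀ {p π} → RiseFree p π → T (noRise p π)
  complete []               = _
  complete [-]              = _
  complete {p} (asc ∷ rest) = from T-∧ (from (ascent⇔ p) asc , complete rest)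

RiseFree-prefix-mono : ∀ {p q π} → (∀ {x} → x ∈ π → All (x ≤_) q → All (x ≤_) p) →
                       RiseFree q π → RiseFree p π
RiseFree-prefix-mono _ []  = []
RiseFree-prefix-mono _ [-] = [-]
RiseFree-prefix-mono {p} {q} {x ∷ y ∷ r} mono (asc ∷ rest) =
  mono (here refl) ∘ asc ∷ RiseFree-prefix-mono mono′ rest
  where
  mono′ : ∀ {z} → z ∈ y ∷ r → All (z ≤_) (q ++ [ x ]) → All (z ≤_) (p ++ [ x ])
  mono′ z∈ z≤ with z≤q , z≤x ← Allₚ.++⁻ q z≤ = Allₚ.++⁺ (mono (there z∈) z≤q) z≤x

RiseFree-tail : ∀ {p x π} → RiseFree p (x ∷ π) → RiseFree p π
RiseFree-tail     [-]        = []
RiseFree-tail {p} (_ ∷ rest) = RiseFree-prefix-mono (λ _ → Allₚ.++⁻ˡ p) rest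

RiseFree-++⁻ˡ : ∀ {p} xs {ys} → RiseFree p (xs ++ ys) → RiseFree p xs
RiseFree-++⁻ˡ []           _            = []
RiseFree-++⁻ˡ (x ∷ [])     _            = [-]
RiseFree-++⁻ˡ (x ∷ y ∷ xs) (asc ∷ rest) = asc ∷ RiseFree-++⁻ˡ (y ∷ xs) rest

RiseFree-++⁻ʳ : ∀ {p} xs {ys} → RiseFree p (xs ++ ys) → RiseFree p ys
RiseFree-++⁻ʳ []       r = r
RiseFree-++⁻ʳ (x ∷ xs) r = RiseFree-++⁻ʳ xs (RiseFree-tail r)

≪-∷ʳ : ∀ {B p a A} → B ≪ p → B ≪ (a ∷ A) → B ≪ (p ++ [ a ])
≪-∷ʳ []          []                = []
≪-∷ʳ (b<p ∷ B≪p) ((b<a ∷ _) ∷ B≪A) = Allₚ.++⁺ b<p (b<a ∷ []) ∷ ≪-∷ʳ B≪p B≪A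

RiseFree-++-≪ : ∀ {p} A {B} → RiseFree p A → RiseFree [] B → B ≪ p → B ≪ A → RiseFree p (A ++ B)
RiseFree-++-≪ []           _            rB B≪p _   =
  RiseFree-prefix-mono (λ z∈ _ → All.map <⇒≤ (All.lookup B≪p z∈)) rB
RiseFree-++-≪ (a ∷ [])     {[]}    _    _  _   _   = [-]
RiseFree-++-≪ (a ∷ [])     {b ∷ B} _    rB B≪p B≪A =
  (λ a<b → ⊥-elim (<-asym a<b (All.head (All.head B≪A)))) ∷
  RiseFree-++-≪ [] [] rB (≪-∷ʳ B≪p B≪A) (All.map (const []) B≪A)
RiseFree-++-≪ (a ∷ a′ ∷ A) (asc ∷ rest) rB B≪p B≪A =
  asc ∷ RiseFree-++-≪ (a′ ∷ A) rest rB (≪-∷ʳ B≪p B≪A) (All.map All.tail B≪A)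

RiseFree-append-after-min : ∀ {p} xs {x y} → RiseFree p (xs ++ [ x ]) → All (x ≤_) p → All (x ≤_) xs →
                            RiseFree p (xs ++ x ∷ y ∷ [])
RiseFree-append-after-min []           [-]          x≤p _            = const x≤p ∷ [-]
RiseFree-append-after-min (a ∷ [])     (asc ∷ rest) x≤p (x≤a ∷ _)    =
  asc ∷ RiseFree-append-after-min [] rest (Allₚ.++⁺ x≤p (x≤a ∷ [])) []
RiseFree-append-after-min (a ∷ b ∷ xs) (asc ∷ rest) x≤p (x≤a ∷ x≤xs) =
  asc ∷ RiseFree-append-after-min (b ∷ xs) rest (Allₚ.++⁺ x≤p (x≤a ∷ [])) x≤xs

RiseFree-ascent-minimal : ∀ ws {p x y r} → RiseFree p (ws ++ x ∷ y ∷ r) → x < y → All (x ≤_) p × All (x ≤_) ws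
RiseFree-ascent-minimal []           (asc ∷ _) x<y = asc x<y , []
RiseFree-ascent-minimal (w ∷ [])     {p} (_ ∷ rest) x<y
  with x≤pw , _ ← RiseFree-ascent-minimal [] rest x<y = Allₚ.++⁻ p x≤pw
RiseFree-ascent-minimal (w ∷ b ∷ ws) {p} (_ ∷ rest) x<y
  with x≤pw , x≤ws ← RiseFree-ascent-minimal (b ∷ ws) rest x<y
  = Product.map₂ (λ { (x≤w ∷ []) → x≤w ∷ x≤ws }) (Allₚ.++⁻ p x≤pw)

-- Strictly increasing relabellings

module _ {f : ℕ → ℕ} (f-mono : f Preserves _<_ ⟶ _<_) where

  <⇔f< : ∀ {a b} → a < b ⇔ f a < f b
  <⇔f< {a} {b} = mk⇔ f-mono reflect
    where
    reflect : f a < f b → a < b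
    reflect fa<fb with <-cmp a b
    ... | tri< a<b _ _  = a<b
    ... | tri≈ _ refl _ = ⊥-elim (<-irrefl refl fa<fb)
    ... | tri> _ _ b<a  = ⊥-elim (<-asym fa<fb (f-mono b<a))

  ≤⇔f≤ : ∀ {a b} → a ≤ b ⇔ f a ≤ f b
  ≤⇔f≤ = mk⇔ (λ a≤b → ≮⇒≥ λ fb<fa → <⇒≱ (from <⇔f< fb<fa) a≤b)
             (λ fa≤fb → ≮⇒≥ λ b<a → <⇒≱ (to <⇔f< b<a) fa≤fb)

  ≅-map : ∀ {s t} → map f s ≅ t ⇔ s ≅ t
  ≅-map = mk⇔ unmap remap
    where
    unmap : ∀ {s t} → map f s ≅ t → s ≅ t
    unmap {[]}    []      = []
    unmap {_ ∷ _} (p ∷ r) = unmapₚ p ∷ unmap r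
      where
      unmapₚ : ∀ {x y xs ys} → Pointwise (SameOrder (f x) y) (map f xs) ys → Pointwise (SameOrder x y) xs ys
      unmapₚ {xs = []}    []      = []
      unmapₚ {xs = _ ∷ _} (e ∷ p) = e ⇔-∘ <⇔f< ∷ unmapₚ p
    remap : ∀ {s t} → s ≅ t → map f s ≅ t
    remap []      = []
    remap (p ∷ r) = remapₚ p ∷ remap r
      where
      remapₚ : ∀ {x y xs ys} → Pointwise (SameOrder x y) xs ys → Pointwise (SameOrder (f x) y) (map f xs) ys
      remapₚ []      = []
      remapₚ (e ∷ p) = e ⇔-∘ ⇔-sym <⇔f< ∷ remapₚ p

  Contains-map : ∀ {π σ} → Contains (map f π) σ ⇔ Contains π σ
  Contains-map {π} = mk⇔ unmap remap
    where
    unmap : ∀ {σ} → Contains (map f π) σ → Contains π σ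
    unmap (s′ , s′⊆ , s′≅) with s , refl , s⊆π ← ⊆-map⁻ f π s′⊆ = s , s⊆π , to ≅-map s′≅
    remap : ∀ {σ} → Contains π σ → Contains (map f π) σ
    remap (s , s⊆π , s≅) = map f s , ⊆-map⁺ f s⊆π , from ≅-map s≅

  Contains-mapʳ : ∀ {π σ} → Contains π (map f σ) ⇔ Contains π σ
  Contains-mapʳ = mk⇔ (Product.map₂ (Product.map₂ (≅-sym ∘ to ≅-map ∘ ≅-sym)))
                      (Product.map₂ (Product.map₂ (≅-sym ∘ from ≅-map ∘ ≅-sym)))

  RiseFree-map : ∀ {p π} → RiseFree (map f p) (map f π) ⇔ RiseFree p π
  RiseFree-map = mk⇔ (unmap _ _) (remap _ _)
    where
    unmap : ∀ p π → RiseFree (map f p) (map f π) → RiseFree p π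
    unmap p []          _            = []
    unmap p (x ∷ [])    _            = [-]
    unmap p (x ∷ y ∷ r) (asc ∷ rest) =
      (λ x<y → All.map (from ≤⇔f≤) (Allₚ.map⁻ (asc (to <⇔f< x<y)))) ∷
      unmap (p ++ [ x ]) (y ∷ r) (subst (λ q → RiseFree q _) (sym (map-++ f p [ x ])) rest)
    remap : ∀ p π → RiseFree p π → RiseFree (map f p) (map f π)
    remap p []          _            = []
    remap p (x ∷ [])    _            = [-]
    remap p (x ∷ y ∷ r) (asc ∷ rest) =
      (λ fx<fy → Allₚ.map⁺ (All.map (to ≤⇔f≤) (asc (from <⇔f< fx<fy)))) ∷
      subst (λ q → RiseFree q _) (map-++ f p [ x ]) (remap (p ++ [ x ]) (y ∷ r) rest)

-- Distinct entries

notIn⇔ : ∀ {x} xs → T (notIn x xs) ⇔ All (x ≢_) xs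
notIn⇔         []       = mk⇔ (const []) (const _)
notIn⇔ {x} (y ∷ xs) with x ≡ᵇ y in eq
... | true  = mk⇔ (λ ()) (λ { (x≢y ∷ _) → x≢y (≡ᵇ⇒≡ x y (subst T (sym eq) _)) })
... | false = mk⇔ (λ h → (λ x≡y → subst T eq (≡⇒≡ᵇ x y x≡y)) ∷ to (notIn⇔ xs) h)
                  (λ { (_ ∷ x≢xs) → from (notIn⇔ xs) x≢xs })

distinct⇔Unique : ∀ {xs} → T (distinct xs) ⇔ Unique xs
distinct⇔Unique {[]}     = mk⇔ (const []) (const _)
distinct⇔Unique {x ∷ xs} = mk⇔
  (λ h → let x∉ , u = to (T-∧ {notIn x xs}) h in to (notIn⇔ xs) x∉ ∷ to distinct⇔Unique u)
  (λ { (x∉ ∷ u) → from T-∧ (from (notIn⇔ xs) x∉ , from distinct⇔Unique u) })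

Unique-⊆ : ∀ {xs ys : List ℕ} → xs ⊆ ys → Unique ys → Unique xs
Unique-⊆ []         []       = []
Unique-⊆ (_ ∷ʳ p)   (_ ∷ u)  = Unique-⊆ p u
Unique-⊆ (refl ∷ p) (x∉ ∷ u) = All-resp-⊆ p x∉ ∷ Unique-⊆ p u

Unique-++⁻ : ∀ (xs : List ℕ) {ys} → Unique (xs ++ ys) → All (λ a → All (a ≢_) ys) xs
Unique-++⁻ []       _        = []
Unique-++⁻ (x ∷ xs) (x∉ ∷ u) = Allₚ.++⁻ʳ xs x∉ ∷ Unique-++⁻ xs u

≪⇒Disjoint : ∀ {A B} → B ≪ A → ∀ {v} → ¬ (v ∈ A × v ∈ B)
≪⇒Disjoint B≪A (v∈A , v∈B) = <-irrefl refl (All.lookup (All.lookup B≪A v∈B) v∈A)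

infix 4 _≢?_
_≢?_ : ∀ v t → Dec (v ≢ t)
v ≢? t = ¬? (v ≟ t)

length≤1+length-filter-≢ : ∀ t {xs} → Unique xs → length xs ≤ suc (length (filter (_≢? t) xs))
length≤1+length-filter-≢ t {[]}     _        = z≤n
length≤1+length-filter-≢ t {v ∷ xs} (v∉ ∷ u) with v ≟ t
... | yes refl = s≤s (≤-reflexive (cong length (sym (trans (filter-reject (_≢? t) (λ t≢t → t≢t refl))
                   (filter-all (_≢? t) (All.map ≢-sym v∉))))))
... | no v≢t   = subst (λ l → suc (length xs) ≤ suc l) (cong length (sym (filter-accept (_≢? t) v≢t)))
                       (s≤s (length≤1+length-filter-≢ t u))

pigeonhole : ∀ c {lo xs} → Unique xs → All (λ v → lo < v × v ≤ lo + c) xs → length xs ≤ c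
pigeonhole zero    {lo} {[]}    _ _                   = z≤n
pigeonhole zero    {lo} {_ ∷ _} _ ((lo<v , v≤lo) ∷ _) = ⊥-elim (<⇒≱ lo<v (subst (_ ≤_) (+-identityʳ lo) v≤lo))
pigeonhole (suc c) {lo} {xs} u bounds =
  ≤-trans (length≤1+length-filter-≢ (lo + suc c) u)
          (s≤s (pigeonhole c (Uniqueₚ.filter⁺ (_≢? lo + suc c) u) bounds′))
  where
  bounds′ : All (λ v → lo < v × v ≤ lo + c) (filter (_≢? lo + suc c) xs)
  bounds′ = All.zipWith (λ {v} (v≢t , lo<v , v≤t) → lo<v , s≤s⁻¹ (subst (v <_) (+-suc lo c) (≤∧≢⇒< v≤t v≢t)))
                        (Allₚ.all-filter (_≢? lo + suc c) xs , Allₚ.filter⁺ (_≢? lo + suc c) bounds)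

-- Motzkin permutations

record Motzkin (n : ℕ) (π : List ℕ) : Set where
  field
    length≡   : length π ≡ n
    bounded   : All (λ x → 1 ≤ x × x ≤ n) π
    unique    : Unique π
    avoids132 : ¬ Contains π 132-pattern
    riseFree  : RiseFree [] π

inM⇔Motzkin : ∀ {n π} → T (inM n π) ⇔ Motzkin n π
inM⇔Motzkin {n} {π} = mk⇔ sound complete
  where
  inRange? : ℕ → Bool
  inRange? x = (1 ≤ᵇ x) ∧ (x ≤ᵇ n)
  inRange⇔ : ∀ {x} → T (inRange? x) ⇔ (1 ≤ x × x ≤ n)
  inRange⇔ {x} = mk⇔ (Product.map (≤ᵇ⇒≤ 1 x) (≤ᵇ⇒≤ x n) ∘ to (T-∧ {1 ≤ᵇ x})) (from T-∧ ∘ Product.map ≤⇒≤ᵇ ≤⇒≤ᵇ)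
  sound : T (inM n π) → Motzkin n π
  sound h
    with perm , motz ← to (T-∧ {isPermOf n π}) h
    with len , rng∧dst ← to (T-∧ {length π ≡ᵇ n}) perm
    with rng , dst ← to (T-∧ {all inRange? π}) rng∧dst
    with a132 , nr ← to (T-∧ {avoids π 132-pattern}) motz = record
      { length≡   = ≡ᵇ⇒≡ _ _ len
      ; bounded   = All.map (to inRange⇔) (Allₚ.all⁺ inRange? π rng)
      ; unique    = to distinct⇔Unique dst
      ; avoids132 = to avoids⇔ a132
      ; riseFree  = to noRise⇔RiseFree nr
      }
  complete : Motzkin n π → T (inM n π)
  complete m = from T-∧ (from T-∧ (≡⇒≡ᵇ _ _ length≡ ,
                 from T-∧ (Allₚ.all⁻ inRange? (All.map (from inRange⇔) bounded) , from distinct⇔Unique unique)) ,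
               from T-∧ (from avoids⇔ avoids132 , from noRise⇔RiseFree riseFree))
    where open Motzkin m

M-member⇔ : ∀ {n σ π} → T (inM n π ∧ avoids π σ) ⇔ (Motzkin n π × ¬ Contains π σ)
M-member⇔ {n} {σ} {π} = mk⇔ (Product.map (to inM⇔Motzkin) (to avoids⇔) ∘ to (T-∧ {inM n π}))
                            (from T-∧ ∘ Product.map (from inM⇔Motzkin) (from avoids⇔))

M-Motzkin : ∀ {n σ} (x : M n σ) → Motzkin n (proj₁ x)
M-Motzkin {n} {σ} (π , π∈) = proj₁ (to (M-member⇔ {n} {σ} {π}) π∈)

M-avoids : ∀ {n σ} (x : M n σ) → ¬ Contains (proj₁ x) σ
M-avoids {n} {σ} (π , π∈) = proj₂ (to (M-member⇔ {n} {σ} {π}) π∈)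

M-≡ : ∀ {n σ} {x y : M n σ} → proj₁ x ≡ proj₁ y → x ≡ y
M-≡ {x = π , p} {y = .π , q} refl = cong (π ,_) (T-irrelevant p q)

M-singleton : ∀ {n σ} (x : M n σ) → (∀ (y : M n σ) → proj₁ y ≡ proj₁ x) → Fin 1 ↔ M n σ
M-singleton x only-x = mk↔ₛ′ (const x) (const zero) (λ y → M-≡ (sym (only-x y))) (λ { zero → refl })

Motzkin-[] : Motzkin 0 []
Motzkin-[] = record
  { length≡   = refl
  ; bounded   = []
  ; unique    = []
  ; avoids132 = λ occ → <⇒≱ (s≤s z≤n) (Contains-length occ)
  ; riseFree  = []
  }

Motzkin-[1] : Motzkin 1 [ 1 ]
Motzkin-[1] = record
  { length≡   = refl
  ; bounded   = (≤-refl , ≤-refl) ∷ []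
  ; unique    = [] ∷ []
  ; avoids132 = λ occ → <⇒≱ (s≤s (s≤s z≤n)) (Contains-length occ)
  ; riseFree  = [-]
  }

-- map (c +_) α ++ β is the skew sum α ⊖ β.
Motzkin-⊖ : ∀ {m c α β} → Motzkin m α → Motzkin c β → Motzkin (c + m) (map (c +_) α ++ β)
Motzkin-⊖ {m} {c} {α} {β} mα mβ = record
  { length≡   = trans (length-++ (map (c +_) α))
                      (trans (cong₂ _+_ (trans (length-map _ α) (Motzkin.length≡ mα)) (Motzkin.length≡ mβ))
                             (+-comm m c))
  ; bounded   = Allₚ.++⁺ (Allₚ.map⁺ (All.map (λ (1≤x , x≤m) → ≤-trans 1≤x (m≤n+m _ c) , +-monoʳ-≤ c x≤m)
                                              (Motzkin.bounded mα)))
                         (All.map (Product.map₂ (λ x≤c → ≤-trans x≤c (m≤m+n c m))) (Motzkin.bounded mβ))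
  ; unique    = Uniqueₚ.++⁺ (Uniqueₚ.map⁺ (+-cancelˡ-≡ c _ _) (Motzkin.unique mα)) (Motzkin.unique mβ)
                            (≪⇒Disjoint β≪α)
  ; avoids132 = either (Motzkin.avoids132 mα ∘ to (Contains-map (+-monoʳ-< c))) (Motzkin.avoids132 mβ)
                ∘ Contains-++-≪ β≪α (s≤s (s≤s z≤n) ∷ s≤s (s≤s z≤n) ∷ [])
  ; riseFree  = RiseFree-++-≪ (map (c +_) α) (from (RiseFree-map (+-monoʳ-< c)) (Motzkin.riseFree mα))
                              (Motzkin.riseFree mβ) (All.map (const []) (Motzkin.bounded mβ)) β≪α
  }
  where
  β≪α : β ≪ map (c +_) α
  β≪α = All.map (λ (_ , b≤c) → Allₚ.map⁺ (All.map (λ (1≤x , _) → ≤-<-trans b≤c (m<m+n c 1≤x))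
                                                  (Motzkin.bounded mα)))
                (Motzkin.bounded mβ)

Motzkin-append-max : ∀ xs {x c} → All (x ≤_) xs → Motzkin c (xs ++ [ x ]) → Motzkin (suc c) (xs ++ x ∷ suc c ∷ [])
Motzkin-append-max xs {x} {c} x≤xs m = record
  { length≡   = trans (length-++ xs) (trans (+-suc (length xs) 1) (cong suc (trans (sym (length-++ xs)) length≡)))
  ; bounded   = subst (All _) assoc (Allₚ.++⁺ (All.map (Product.map₂ m≤n⇒m≤1+n) bounded) ((s≤s z≤n , ≤-refl) ∷ []))
  ; unique    = subst Unique assoc
                      (Uniqueₚ.++⁺ unique ([] ∷ []) λ { (v∈ , here refl) → <-irrefl refl (All.lookup below v∈) })
  ; avoids132 = avoids132 ∘ Contains-∷ʳ⁻ {σ = 1 ∷ 3 ∷ []} (there (here refl)) (All.map 3≮2 below)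
                          ∘ subst (λ π → Contains π 132-pattern) (sym assoc)
  ; riseFree  = RiseFree-append-after-min xs riseFree [] x≤xs
  }
  where
  open Motzkin m
  assoc : (xs ++ [ x ]) ++ [ suc c ] ≡ xs ++ x ∷ suc c ∷ []
  assoc = ++-assoc xs [ x ] [ suc c ]
  below : All (_< suc c) (xs ++ [ x ])
  below = All.map (s≤s ∘ proj₂) bounded
  3≮2 : ∀ {a} → a < suc c → ¬ SameOrder a 3 (suc c) 2
  3≮2 a<c e with to e a<c
  ... | s≤s (s≤s ())

Unique-factor : ∀ ws c {s vs} → Unique (ws ++ map (c +_) s ++ vs) → Unique s
Unique-factor ws c {vs = vs} = Uniqueₚ.map⁻ ∘ Unique-⊆ (++⁺ˡ ws (++⁺ʳ vs ⊆-refl))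

Contains-factor : ∀ ws c {s vs σ} → Contains s σ → Contains (ws ++ map (c +_) s ++ vs) σ
Contains-factor ws c {vs = vs} = Contains-⊆ (++⁺ˡ ws (++⁺ʳ vs ⊆-refl)) ∘ from (Contains-map (+-monoʳ-< c))

Motzkin-factor : ∀ ws c {N n s vs} → Motzkin N (ws ++ map (c +_) s ++ vs) →
                 length s ≡ n → All (λ x → 1 ≤ x × x ≤ n) s → Motzkin n s
Motzkin-factor ws c {s = s} m len bnd = record
  { length≡   = len
  ; bounded   = bnd
  ; unique    = Unique-factor ws c unique
  ; avoids132 = avoids132 ∘ Contains-factor ws c
  ; riseFree  = to (RiseFree-map (+-monoʳ-< c)) (RiseFree-++⁻ˡ (map (c +_) s) (RiseFree-++⁻ʳ ws riseFree))
  }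
  where open Motzkin m

Motzkin-1∈ : ∀ {n π} → Motzkin (suc n) π → 1 ∈ π
Motzkin-1∈ {n} {π} m with 1 ∈? π
... | yes 1∈π = 1∈π
... | no  1∉π = ⊥-elim (<-irrefl refl (subst (_≤ n) length≡ (pigeonhole n unique above1)))
  where
  open Motzkin m
  above1 : All (λ v → 1 < v × v ≤ 1 + n) π
  above1 = All.zipWith (λ (1≢v , 1≤v , v≤) → ≤∧≢⇒< 1≤v 1≢v , v≤) (¬Any⇒All¬ π 1∉π , bounded)

Motzkin-before-1 : ∀ {N} σ {rest} → Motzkin N (σ ++ 1 ∷ rest) → All (λ a → 1 < a × a ≤ N) σ
Motzkin-before-1 σ m =
  All.zipWith (λ { ((a≢1 ∷ _) , 1≤a , a≤N) → ≤∧≢⇒< 1≤a (≢-sym a≢1) , a≤N })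
              (Unique-++⁻ σ (Motzkin.unique m) , Allₚ.++⁻ˡ σ (Motzkin.bounded m))

Motzkin-¬two-after-1 : ∀ {n} σ {x y r} → ¬ Motzkin n (σ ++ 1 ∷ x ∷ y ∷ r)
Motzkin-¬two-after-1 σ {x} {y} {r} m with Unique-⊆ (++⁺ˡ σ ⊆-refl) (Motzkin.unique m)
... | (1≢x ∷ 1≢y ∷ _) ∷ (x≢y ∷ _) ∷ _ = compare (<-cmp x y)
  where
  open Motzkin m
  1<entry : ∀ {v} → 1 ≢ v → v ∈ 1 ∷ x ∷ y ∷ r → 1 < v
  1<entry 1≢v v∈ = ≤∧≢⇒< (proj₁ (All.lookup bounded (∈-++⁺ʳ σ v∈))) 1≢v
  compare : Tri (x < y) (x ≡ y) (y < x) → ⊥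
  compare (tri< x<y _ _) = <⇒≱ (1<entry 1≢x (there (here refl))) (All.lookup x≤σ1 (∈-++⁺ʳ σ (here refl)))
    where
    x≤σ1 : All (x ≤_) (σ ++ [ 1 ])
    x≤σ1 = proj₂ (RiseFree-ascent-minimal (σ ++ [ 1 ])
                                          (subst (RiseFree []) (sym (++-assoc σ [ 1 ] _)) riseFree) x<y)
  compare (tri≈ _ x≡y _) = x≢y x≡y
  compare (tri> _ _ y<x) =
    avoids132 (_ , ++⁺ˡ σ (refl ∷ refl ∷ refl ∷ minimum r) , ≅132 (1<entry 1≢y (there (there (here refl)))) y<x)

Motzkin-2+-after-1 : ∀ {n} σ {j} → Motzkin n (σ ++ 1 ∷ j ∷ []) → ∃[ i ] j ≡ 2 + i
Motzkin-2+-after-1 σ m with Unique-⊆ (++⁺ˡ σ ⊆-refl) (Motzkin.unique m)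
... | (1≢j ∷ []) ∷ _ with ≤∧≢⇒< (proj₁ (All.lookup (Motzkin.bounded m) (∈-++⁺ʳ σ (there (here refl))))) 1≢j
... | s≤s (s≤s z≤n) = _ , refl

132-split : ∀ σ {j} → ¬ Contains (σ ++ [ j ]) 132-pattern → j ∉ σ →
            ∃₂ λ G D → σ ≡ G ++ D × All (j <_) G × All (_< j) D
132-split []      _ _ = [] , [] , refl , [] , []
132-split (v ∷ σ) {j} avoid j∉ with <-cmp v j
... | tri< v<j _ _ = [] , v ∷ σ , refl , [] , v<j ∷ All.tabulate below
  where
  below : ∀ {b} → b ∈ σ → b < j
  below {b} b∈ with <-cmp b j
  ... | tri< b<j _ _  = b<j
  ... | tri≈ _ refl _ = ⊥-elim (j∉ (there b∈))
  ... | tri> _ _ j<b  = ⊥-elim (avoid (_ , refl ∷ ⊆-++⁺ (from∈ b∈) ⊆-refl , ≅132 v<j j<b))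
... | tri≈ _ refl _ = ⊥-elim (j∉ (here refl))
... | tri> _ _ j<v with G , D , refl , j<G , D<j ← 132-split σ (avoid ∘ Contains-⊆ (v ∷ʳ ⊆-refl)) (j∉ ∘ there)
  = v ∷ G , D , refl , j<v ∷ j<G , D<j

unshift : ∀ c {N xs} → All (λ v → c < v × v ≤ N) xs →
          ∃[ ys ] xs ≡ map (c +_) ys × All (λ w → 1 ≤ w × w ≤ N ∸ c) ys
unshift c []                  = [] , refl , []
unshift c ((c<v , v≤N) ∷ bnd) with ys , refl , bnd′ ← unshift c bnd =
  _ ∷ ys , cong (_∷ _) (sym (m+[n∸m]≡n (<⇒≤ c<v))) , (m<n⇒0<n∸m c<v , ∸-monoˡ-≤ c v≤N) ∷ bnd′

+-≤-tight : ∀ {a b A B} → a ≤ A → b ≤ B → a + b ≡ A + B → a ≡ A × b ≡ B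
+-≤-tight {a} {b} {A} {B} a≤A b≤B eq =
  ≤-antisym a≤A (+-cancelʳ-≤ B A a (subst (_≤ a + B) eq (+-monoʳ-≤ a b≤B))) ,
  ≤-antisym b≤B (+-cancelˡ-≤ A B b (subst (_≤ A + b) eq (+-monoˡ-≤ b a≤A)))

length-++-≡ : ∀ (xs : List ℕ) {ys n} → length (xs ++ ys) ≡ n + length ys → length xs ≡ n
length-++-≡ xs {ys} eq = +-cancelʳ-≡ (length ys) _ _ (trans (sym (length-++ xs)) eq)

++-cancel-length : ∀ (xs xs′ : List ℕ) {ys ys′} → length xs ≡ length xs′ → xs ++ ys ≡ xs′ ++ ys′ →
                   xs ≡ xs′ × ys ≡ ys′
++-cancel-length []       []         _ eq = refl , eq
++-cancel-length (x ∷ xs) (x′ ∷ xs′) ℓ eq with refl , eq′ ← ∷-injective eq =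
  Product.map₁ (cong (x ∷_)) (++-cancel-length xs xs′ (suc-injective ℓ) eq′)

appendMin : List ℕ → List ℕ
appendMin σ = map suc σ ++ [ 1 ]

assemble : ℕ → List ℕ → List ℕ → List ℕ
assemble i δ γ = map (2 + i +_) γ ++ map suc δ ++ 1 ∷ 2 + i ∷ []

assemble-Motzkin : ∀ {i m δ γ} → Motzkin i δ → Motzkin m γ → Motzkin (2 + i + m) (assemble i δ γ)
assemble-Motzkin {δ = δ} mδ mγ =
  Motzkin-⊖ mγ (Motzkin-append-max (map suc δ) (Allₚ.map⁺ (All.map (const (s≤s z≤n)) (Motzkin.bounded mδ)))
                                   (Motzkin-⊖ mδ Motzkin-[1]))

assemble-lengths : ∀ {n i δ γ} → Motzkin (2 + n) (assemble i δ γ) →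
                   All (λ w → 1 ≤ w × w ≤ i) δ → All (λ w → 1 ≤ w × w ≤ n ∸ i) γ →
                   i ≤ n × length δ ≡ i × length γ ≡ n ∸ i
assemble-lengths {n} {i} {δ} {γ} m δ-bnd γ-bnd = i≤n , proj₂ tight , proj₁ tight
  where
  open ≡-Reasoning
  G D : List ℕ
  G = map (2 + i +_) γ
  D = map suc δ
  i≤n : i ≤ n
  i≤n = s≤s⁻¹ (s≤s⁻¹ (proj₂ (All.lookup (Motzkin.bounded m) (∈-++⁺ʳ G (∈-++⁺ʳ D (there (here refl)))))))
  lengths : length γ + length δ ≡ n ∸ i + i
  lengths = begin
    length γ + length δ    ≡⟨ cong₂ _+_ (length-map (2 + i +_) γ) (length-map suc δ) ⟨
    length G + length D    ≡⟨ length-++ G ⟨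
    length (G ++ D)        ≡⟨ length-++-≡ (G ++ D) {1 ∷ 2 + i ∷ []}
                                (trans (cong length (++-assoc G D _)) (trans (Motzkin.length≡ m) (+-comm 2 n))) ⟩
    n                      ≡⟨ m∸n+n≡m i≤n ⟨
    n ∸ i + i              ∎
  tight : length γ ≡ n ∸ i × length δ ≡ i
  tight = +-≤-tight (pigeonhole (n ∸ i) (Unique-factor [] (2 + i) (Motzkin.unique m)) γ-bnd)
                    (pigeonhole i (Unique-factor G 1 (Motzkin.unique m)) δ-bnd) lengths

assemble-∷ʳ : ∀ i δ γ → assemble i δ γ ≡ (map (2 + i +_) γ ++ map suc δ ++ [ 1 ]) ++ [ 2 + i ]
assemble-∷ʳ i δ γ = sym (trans (++-assoc (map (2 + i +_) γ) (map suc δ ++ [ 1 ]) _)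
                               (cong (map (2 + i +_) γ ++_) (++-assoc (map suc δ) [ 1 ] _)))

assemble-injective : ∀ {i δ δ′ γ γ′} → length γ ≡ length γ′ → assemble i δ γ ≡ assemble i δ′ γ′ → δ ≡ δ′ × γ ≡ γ′
assemble-injective {i} {δ} {δ′} {γ} {γ′} same-length eq
  with G≡G′ , rest ← ++-cancel-length (map (2 + i +_) γ) (map (2 + i +_) γ′)
                       (trans (length-map _ γ) (trans same-length (sym (length-map _ γ′)))) eq
  = map-injective suc-injective (++-cancelʳ (1 ∷ 2 + i ∷ []) (map suc δ) (map suc δ′) rest) ,
    map-injective (+-cancelˡ-≡ (2 + i) _ _) G≡G′

-- Convolutions

-- Indexed by m + i so that shifting A follows the recursion of Defs.conv.
Convolution : (ℕ → Set) → (ℕ → Set) → ℕ → Set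
Convolution B A n = Σ[ i ∈ ℕ ] Σ[ m ∈ ℕ ] m + i ≡ n × B i × A m

module _ {B A : ℕ → Set} where

  Convolution-zero : (B 0 × A 0) ↔ Convolution B A 0
  Convolution-zero = mk↔ₛ′ to′ from′ (λ { (_ , zero , refl , _ , _) → refl }) (λ _ → refl)
    where
    to′ : B 0 × A 0 → Convolution B A 0
    to′ (x , y) = 0 , 0 , refl , x , y
    from′ : Convolution B A 0 → B 0 × A 0
    from′ (_ , zero , refl , x , y) = x , y

  Convolution-suc : ∀ n → ((B (suc n) × A 0) ⊎ Convolution B (A ∘ suc) n) ↔ Convolution B A (suc n)
  Convolution-suc n = mk↔ₛ′ to′ from′ to∘from from∘to
    where
    to′ : (B (suc n) × A 0) ⊎ Convolution B (A ∘ suc) n → Convolution B A (suc n)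
    to′ (inj₁ (x , y))             = suc n , 0 , refl , x , y
    to′ (inj₂ (i , m , e , x , y)) = i , suc m , cong suc e , x , y
    from′ : Convolution B A (suc n) → (B (suc n) × A 0) ⊎ Convolution B (A ∘ suc) n
    from′ (_ , zero  , refl , x , y) = inj₁ (x , y)
    from′ (i , suc m , e    , x , y) = inj₂ (i , m , suc-injective e , x , y)
    to∘from : ∀ c → to′ (from′ c) ≡ c
    to∘from (_ , zero  , refl , _ , _) = refl
    to∘from (i , suc m , e    , x , y) = cong (λ e′ → i , suc m , e′ , x , y) (≡-irrelevant _ _)
    from∘to : ∀ c → from′ (to′ c) ≡ c
    from∘to (inj₁ _)                 = refl
    from∘to (inj₂ (i , m , e , x , y)) = cong (λ e′ → inj₂ (i , m , e′ , x , y)) (≡-irrelevant _ _)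

conv-↔ : ∀ {b B} → (∀ n → Fin (b n) ↔ B n) → ∀ n {a A} → (∀ n → Fin (a n) ↔ A n) →
         Fin (conv b a n) ↔ Convolution B A n
conv-↔ count-b zero    count-a = ↔-trans *↔× (↔-trans (count-b 0 ×-↔ count-a 0) Convolution-zero)
conv-↔ count-b (suc n) count-a =
  ↔-trans +↔⊎ (↔-trans (↔-trans *↔× (count-b (suc n) ×-↔ count-a 0) ⊎-↔ conv-↔ count-b n (count-a ∘ suc))
                       (Convolution-suc n))

-- Avoiders of τ = R 1 k

module AvoidingPattern (R : List ℕ) (k : ℕ) (1<k : 1 < k) (R-bounds : All (λ r → 1 < r × r < k) R) where

  τ : List ℕ
  τ = R ++ 1 ∷ k ∷ []

  ρ : List ℕ
  ρ = map pred R

  ≅τ⁻ : ∀ {s} → Unique s → s ≅ τ → ∃[ u ] ∃₂ λ x y → s ≡ u ++ x ∷ y ∷ [] × u ≅ R × All (λ a → x < a × a < y) u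
  ≅τ⁻ uniq s≅τ with u , x ∷ y ∷ [] , refl , u≅R , _ ∷ _ ∷ [] , cross ← ≅-++⁻ R s≅τ =
    u , x , y , refl , u≅R , All.zipWith strict (Unique-++⁻ u uniq , All-pullback between cross R-bounds)
    where
    between : ∀ {a r} → Pointwise (SameOrder a r) (x ∷ y ∷ []) (1 ∷ k ∷ []) → 1 < r × r < k → x ≤ a × a < y
    between (a<x⇔r<1 ∷ a<y⇔r<k ∷ []) (1<r , r<k) = ≮⇒≥ (λ a<x → <-asym (to a<x⇔r<1 a<x) 1<r) , from a<y⇔r<k r<k
    strict : ∀ {a} → All (a ≢_) (x ∷ y ∷ []) × (x ≤ a × a < y) → x < a × a < y
    strict ((a≢x ∷ _) , x≤a , a<y) = ≤∧≢⇒< x≤a (≢-sym a≢x) , a<y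

  ≅τ⁺ : ∀ {u x y} → u ≅ R → All (λ a → x < a × a < y) u → x < y → u ++ x ∷ y ∷ [] ≅ τ
  ≅τ⁺ u≅R between x<y =
    ≅-++⁺ u≅R ((mk⇔ (const 1<k) (const x<y) ∷ []) ∷ [] ∷ [])
              (Pointwise-fromAll cross (≅-length u≅R) between R-bounds)
    where
    cross : ∀ {a r x y} → x < a × a < y → 1 < r × r < k → Pointwise (SameOrder a r) (x ∷ y ∷ []) (1 ∷ k ∷ [])
    cross (x<a , a<y) (1<r , r<k) =
      mk⇔ (λ a<x → ⊥-elim (<-asym a<x x<a)) (λ r<1 → ⊥-elim (<-asym r<1 1<r)) ∷ mk⇔ (const r<k) (const a<y) ∷ []

  Contains-ρ : ∀ {δ} → Contains δ ρ ⇔ Contains (map suc δ) R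
  Contains-ρ {δ} = subst (λ R′ → Contains δ ρ ⇔ Contains (map suc δ) R′) suc-ρ≡R
                         (⇔-sym (Contains-mapʳ (+-monoʳ-< 1) ⇔-∘ Contains-map (+-monoʳ-< 1)))
    where
    suc-ρ≡R : map suc ρ ≡ R
    suc-ρ≡R = trans (sym (map-∘ R)) (map-id-local (All.map (λ { (s≤s (s≤s z≤n) , _) → refl }) R-bounds))

  short-avoids : ∀ {π} → length π < 2 → ¬ Contains π τ
  short-avoids π<2 occ = <⇒≱ π<2 (≤-trans (m≤n+m 2 (length R)) (subst (_≤ _) (length-++ R) (Contains-length occ)))

  appendMin-avoids : ∀ {σ} → ¬ Contains σ τ → ¬ Contains (appendMin σ) τ
  appendMin-avoids {σ} avoid =
    avoid ∘ to (Contains-map (+-monoʳ-< 1)) ∘ subst (Contains _) (++-assoc R [ 1 ] [ k ])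
    ∘ Contains-∷ʳ⁻ {σ = R ++ [ 1 ]} (∈-++⁺ʳ R (here refl)) (Allₚ.map⁺ (All.tabulate λ _ → nothing-below-1))
    ∘ subst (Contains _) (sym (++-assoc R [ 1 ] [ k ]))
    where
    nothing-below-1 : ∀ {b} → ¬ SameOrder (suc b) 1 1 k
    nothing-below-1 e with from e 1<k
    ... | s≤s ()

  module _ {i m δ γ} (mδ : Motzkin i δ) (mγ : Motzkin m γ) where
    private
      j : ℕ
      j = 2 + i
      G Tail : List ℕ
      G    = map (j +_) γ
      Tail = map suc δ ++ 1 ∷ j ∷ []
      j<G : All (j <_) G
      j<G = Allₚ.map⁺ (All.map (λ (1≤w , _) → m<m+n j 1≤w) (Motzkin.bounded mγ))
      Tail≤j : All (_≤ j) Tail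
      Tail≤j = Allₚ.++⁺ (Allₚ.map⁺ (All.map (λ (_ , w≤i) → s≤s (m≤n⇒m≤1+n w≤i)) (Motzkin.bounded mδ)))
                        (s≤s z≤n ∷ ≤-refl ∷ [])

    assemble-avoids : ¬ Contains δ ρ → ¬ Contains γ τ → ¬ Contains (assemble i δ γ) τ
    assemble-avoids avoidρ avoidτ (s , s⊆ , s≅τ)
      with u , x , y , refl , u≅R , between ← ≅τ⁻ (Unique-⊆ s⊆ (Motzkin.unique (assemble-Motzkin mδ mγ))) s≅τ
      with ∈-++⁻ G (lookup s⊆ (∈-++⁺ʳ u (there (here refl))))
    ... | inj₁ y∈G =
      avoidτ (to (Contains-map (+-monoʳ-< j))
        (_ , ∷ʳ-⊆-++ G (u ++ [ x ]) (subst (_⊆ _) assoc s⊆)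
                     (λ y∈Tail → <⇒≱ (All.lookup j<G y∈G) (All.lookup Tail≤j y∈Tail)) ,
             subst (_≅ τ) assoc s≅τ))
      where
      assoc : u ++ x ∷ y ∷ [] ≡ (u ++ [ x ]) ++ [ y ]
      assoc = sym (++-assoc u [ x ] [ y ])
    ... | inj₂ y∈Tail = avoidρ (from Contains-ρ (u , u⊆D , u≅R))
      where
      1≤x : 1 ≤ x
      1≤x = proj₁ (All.lookup (Motzkin.bounded (assemble-Motzkin mδ mγ)) (lookup s⊆ (∈-++⁺ʳ u (here refl))))
      a<j : ∀ {a} → x < a × a < y → a < j
      a<j (_ , a<y) = <-≤-trans a<y (All.lookup Tail≤j y∈Tail)
      ∉G : ∀ {a} → x < a × a < y → a ∉ G
      ∉G a∈ a∈G = <-asym (a<j a∈) (All.lookup j<G a∈G)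
      ∉1j : ∀ {a} → x < a × a < y → a ∉ 1 ∷ j ∷ []
      ∉1j (x<a , _) (here refl)         = <⇒≱ x<a 1≤x
      ∉1j a∈        (there (here refl)) = <-irrefl refl (a<j a∈)
      u⊆D : u ⊆ map suc δ
      u⊆D = ⊆-++-∉ʳ (map suc δ) (⊆-++-∉ˡ G (⊆-trans (++⁺ʳ _ ⊆-refl) s⊆) (All.map ∉G between)) (All.map ∉1j between)

  decompose-σ1 : ∀ {n} σ → Motzkin (2 + n) (σ ++ [ 1 ]) → ¬ Contains (σ ++ [ 1 ]) τ →
                 ∃[ σ′ ] σ ≡ map suc σ′ × Motzkin (1 + n) σ′ × ¬ Contains σ′ τ
  decompose-σ1 {n} σ m avoid with σ′ , refl , bnd ← unshift 1 (Motzkin-before-1 σ m) =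
    σ′ , refl , Motzkin-factor [] 1 m len bnd , avoid ∘ Contains-factor [] 1
    where
    len : length σ′ ≡ suc n
    len = trans (sym (length-map suc σ′)) (length-++-≡ (map suc σ′) (trans (Motzkin.length≡ m) (+-comm 1 (suc n))))

  decompose-σ1j : ∀ {n} σ i → Motzkin (2 + n) (σ ++ 1 ∷ 2 + i ∷ []) → ¬ Contains (σ ++ 1 ∷ 2 + i ∷ []) τ →
                  ∃[ m ] m + i ≡ n × ∃₂ λ δ γ → σ ≡ map (2 + i +_) γ ++ map suc δ ×
                    (Motzkin i δ × ¬ Contains δ ρ) × (Motzkin m γ × ¬ Contains γ τ)
  decompose-σ1j {n} σ i mπ avoid
    with G , D , refl , j<G , D<j
           ← 132-split σ (Motzkin.avoids132 mπ ∘ Contains-⊆ (⊆-++⁺ ⊆-refl (1 ∷ʳ ⊆-refl)))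
                         (λ j∈σ → All.lookup (All.lookup (Unique-++⁻ σ (Motzkin.unique mπ)) j∈σ)
                                             (there (here refl)) refl)
    with mπ′ ← subst (Motzkin (2 + n)) (++-assoc G D (1 ∷ 2 + i ∷ [])) mπ
    with avoid′ ← avoid ∘ subst (λ π → Contains π τ) (sym (++-assoc G D (1 ∷ 2 + i ∷ [])))
    with G-bnd , D-bnd ← Allₚ.++⁻ G (Motzkin-before-1 (G ++ D) mπ)
    with γ , refl , γ-bnd ← unshift (2 + i) (All.zipWith (λ (j<v , _ , v≤) → j<v , v≤) (j<G , G-bnd))
    with δ , refl , δ-bnd ← unshift 1 (All.zipWith (λ (v<j , 1<v , _) → 1<v , s≤s⁻¹ v<j) (D<j , D-bnd))
    with i≤n , |δ|≡i , |γ|≡n∸i ← assemble-lengths mπ′ δ-bnd γ-bnd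
    = n ∸ i , m∸n+n≡m i≤n , δ , γ , refl ,
      (Motzkin-factor (map (2 + i +_) γ) 1 mπ′ |δ|≡i δ-bnd , avoidρ) ,
      (Motzkin-factor [] (2 + i) mπ′ |γ|≡n∸i γ-bnd , avoid′ ∘ Contains-factor [] (2 + i))
    where
    avoidρ : ¬ Contains δ ρ
    avoidρ occ with u , u⊆D , u≅R ← to Contains-ρ occ =
      avoid′ (_ , ++⁺ˡ (map (2 + i +_) γ) (⊆-++⁺ u⊆D ⊆-refl) ,
              ≅τ⁺ u≅R (All-resp-⊆ u⊆D (All.zipWith (λ (a<j , 1<a , _) → 1<a , a<j) (D<j , D-bnd))) (s≤s (s≤s z≤n)))

  Decomposition : ℕ → Set
  Decomposition n = M (suc n) τ ⊎ Convolution (λ i → M i ρ) (λ m → M m τ) n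

  compose : ∀ n → Decomposition n → M (2 + n) τ
  compose n (inj₁ σ) =
    appendMin (proj₁ σ) , from M-member⇔ (Motzkin-⊖ (M-Motzkin σ) Motzkin-[1] , appendMin-avoids (M-avoids σ))
  compose n (inj₂ (i , m , m+i≡n , δ , γ)) =
    assemble i (proj₁ δ) (proj₁ γ) ,
    from M-member⇔ (subst (λ N → Motzkin N (assemble i (proj₁ δ) (proj₁ γ)))
                          (cong (2 +_) (trans (+-comm i m) m+i≡n))
                          (assemble-Motzkin (M-Motzkin δ) (M-Motzkin γ)) ,
                    assemble-avoids (M-Motzkin δ) (M-Motzkin γ) (M-avoids δ) (M-avoids γ))

  compose-surjective : ∀ n (π : M (2 + n) τ) → ∃[ d ] proj₁ (compose n d) ≡ proj₁ π
  compose-surjective n π@(_ , _) with mπ ← M-Motzkin π | avoid ← M-avoids π | ∈-∃++ (Motzkin-1∈ (M-Motzkin π))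
  ... | σ , [] , refl
    with σ′ , refl , mσ′ , avoidσ′ ← decompose-σ1 σ mπ avoid
    = inj₁ (σ′ , from M-member⇔ (mσ′ , avoidσ′)) , refl
  ... | σ , j ∷ [] , refl
    with i , refl ← Motzkin-2+-after-1 σ mπ
    with m , m+i≡n , δ , γ , refl , (mδ , avoidρ) , (mγ , avoidτ) ← decompose-σ1j σ i mπ avoid
    = inj₂ (i , m , m+i≡n , (δ , from M-member⇔ (mδ , avoidρ)) , (γ , from M-member⇔ (mγ , avoidτ))) ,
      sym (++-assoc (map (2 + i +_) γ) (map suc δ) _)
  ... | σ , _ ∷ _ ∷ _ , refl = ⊥-elim (Motzkin-¬two-after-1 σ mπ)

  compose-injective : ∀ n {d d′} → proj₁ (compose n d) ≡ proj₁ (compose n d′) → d ≡ d′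
  compose-injective n {inj₁ (σ , _)} {inj₁ (σ′ , _)} eq =
    cong inj₁ (M-≡ (map-injective suc-injective (∷ʳ-injectiveˡ (map suc σ) (map suc σ′) eq)))
  compose-injective n {inj₁ (σ , _)} {inj₂ (i , _ , _ , (δ , _) , (γ , _))} eq
    with () ← ∷ʳ-injectiveʳ (map suc σ) _ (trans eq (assemble-∷ʳ i δ γ))
  compose-injective n {inj₂ (i , _ , _ , (δ , _) , (γ , _))} {inj₁ (σ , _)} eq
    with () ← ∷ʳ-injectiveʳ (map suc σ) _ (trans (sym eq) (assemble-∷ʳ i δ γ))
  compose-injective n {inj₂ (i , m , e , (δ , p) , (γ , q))} {inj₂ (i′ , m′ , e′ , (δ′ , p′) , (γ′ , q′))} eq
    with refl ← ∷ʳ-injectiveʳ _ _ (trans (sym (assemble-∷ʳ i δ γ)) (trans eq (assemble-∷ʳ i′ δ′ γ′)))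
    with refl ← +-cancelʳ-≡ i m m′ (trans e (sym e′))
    with refl , refl ← assemble-injective {i} {δ} {δ′} {γ} {γ′}
                         (trans (Motzkin.length≡ (M-Motzkin (γ , q)))
                                (sym (Motzkin.length≡ (M-Motzkin (γ′ , q′))))) eq
    with refl ← ≡-irrelevant e e′ | refl ← T-irrelevant p p′ | refl ← T-irrelevant q q′
    = refl

  compose-↔ : ∀ n → Decomposition n ↔ M (2 + n) τ
  compose-↔ n = mk↔ₛ′ (compose n) (proj₁ ∘ compose-surjective n)
                      (λ π → M-≡ (proj₂ (compose-surjective n π)))
                      (λ d → compose-injective n (proj₂ (compose-surjective n (compose n d))))

  M₀-↔ : Fin 1 ↔ M 0 τ
  M₀-↔ = M-singleton ([] , from M-member⇔ (Motzkin-[] , short-avoids (s≤s z≤n))) only-[]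
    where
    only-[] : (y : M 0 τ) → proj₁ y ≡ []
    only-[] ([] , _)        = refl
    only-[] y@(_ ∷ _ , _) with () ← Motzkin.length≡ (M-Motzkin y)

  M₁-↔ : Fin 1 ↔ M 1 τ
  M₁-↔ = M-singleton ([ 1 ] , from M-member⇔ (Motzkin-[1] , short-avoids ≤-refl)) only-[1]
    where
    only-[1] : (y : M 1 τ) → proj₁ y ≡ [ 1 ]
    only-[1] y@([] , _)        with () ← Motzkin.length≡ (M-Motzkin y)
    only-[1] y@(_ ∷ [] , _)    with (1≤v , v≤1) ∷ [] ← Motzkin.bounded (M-Motzkin y) = cong [_] (≤-antisym v≤1 1≤v)
    only-[1] y@(_ ∷ _ ∷ _ , _) with () ← Motzkin.length≡ (M-Motzkin y)

theorem3p6 : (k : ℕ) → 4 ≤ k → (ρ' : List ℕ) →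
    T (inM k (ρ' ++ (1 ∷ k ∷ []))) →
    (a b : ℕ → ℕ) → Counts a (ρ' ++ (1 ∷ k ∷ [])) → Counts b (map pred ρ') →
    (a 0 ≡ 1) × (a 1 ≡ a 0) ×
    (∀ n → a (suc (suc n)) ≡ a (suc n) + conv b a n)
theorem3p6 k 4≤k ρ′ τ∈𝔐ₖ a b count-a count-b = a₀≡1 , trans a₁≡1 (sym a₀≡1) , recurrence
  where
  τ-Motzkin : Motzkin k (ρ′ ++ 1 ∷ k ∷ [])
  τ-Motzkin = to inM⇔Motzkin τ∈𝔐ₖ
  ρ′-bounds : All (λ r → 1 < r × r < k) ρ′
  ρ′-bounds = All.zipWith (λ { ((_ ∷ r≢k ∷ []) , 1<r , r≤k) → 1<r , ≤∧≢⇒< r≤k r≢k })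
                          (Unique-++⁻ ρ′ (Motzkin.unique τ-Motzkin) , Motzkin-before-1 ρ′ τ-Motzkin)
  open AvoidingPattern ρ′ k (≤-trans (s≤s (s≤s z≤n)) 4≤k) ρ′-bounds
  a₀≡1 : a 0 ≡ 1
  a₀≡1 = ↔⇒≡ (↔-trans (count-a 0) (↔-sym M₀-↔))
  a₁≡1 : a 1 ≡ 1
  a₁≡1 = ↔⇒≡ (↔-trans (count-a 1) (↔-sym M₁-↔))
  recurrence : ∀ n → a (2 + n) ≡ a (1 + n) + conv b a n
  recurrence n = ↔⇒≡ (begin
    Fin (a (2 + n))                      ↔⟨ count-a (2 + n) ⟩
    M (2 + n) τ                          ↔⟨ compose-↔ n ⟨
    Decomposition n                      ↔⟨ count-a (1 + n) ⊎-↔ conv-↔ count-b n count-a ⟨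
    (Fin (a (1 + n)) ⊎ Fin (conv b a n)) ↔⟨ +↔⊎ ⟨
    Fin (a (1 + n) + conv b a n)         ∎)
    where open EquationalReasoning
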